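{- \[ \lim_{q\to\infty}\frac{m_{\frac{q-1}q}}{m_{\frac{q-2}{q-1}}}=\frac{17+\sqrt{285}}{2}. \]
   Context: Generalized Markov numbers $m_{\frac pq}$ for reduced $\tfrac pq\in(0,1]$. Start from three positions with labels $\tfrac01,\tfrac10,\tfrac{ -1}1$, each carrying the number $1$. Mutating a position with label $\tfrac ef$ and number $z$, where the other two positions have labels $\tfrac ab,\tfrac cd$ and numbers $x,y$, does two things. It replaces the label by $\tfrac{a+c}{b+d}$, or by $\tfrac{c-a}{d-b}$ if $\tfrac ef=\tfrac{a+c}{b+d}$. It replaces $z$ by $(x^2+xy+y^2)/z$. Consider mutation sequences starting with position $\tfrac{ -1}1$, then $\tfrac10$, never mutating the same position twice in a row. Every reduced $\tfrac pq\in(0,1]$ occurs as a label, always carrying the same number $m_{\frac pq}$. For example $m_{\frac11}=3$, $m_{\frac12}=13$, $m_{\frac23}=217$, $m_{\frac34}=3673$. -}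

module Defs where

open import Data.Nat as ℕ using (ℕ; zero; suc)
open import Data.Integer as ℤ using (ℤ; +_; -[1+_])
open import Data.Rational as ℚ using (ℚ; 0ℚ)
open import Data.Fin using (Fin; zero; suc)
open import Data.Product using (_×_; _,_; proj₁; proj₂; ∃-syntax)
open import Data.Sum using (_⊎_)
open import Relation.Binary.PropositionalEquality using (_≡_; _≢_)
open import Relation.Nullary using (yes; no)

-- A label a/b is stored as a pair of integers (numerator , denominator).
Label : Set
Label = ℤ × ℤ

_≈L_ : Label → Label → Set
(a , b) ≈L (c , d) = a ℤ.* d ≡ b ℤ.* c

-- Sign normalisation of a fraction: denominator ≥ 0, and 1/0 rather than -1/0.
norm : Label → Label
norm (x , -[1+ n ]) = (ℤ.- x , ℤ.- -[1+ n ])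
norm (-[1+ m ] , + zero) = (ℤ.- -[1+ m ] , + zero)
norm (x , y) = (x , y)

newLabel : Label → Label → Label → Label
newLabel (a , b) (c , d) (e , f) with (e ℤ.* (b ℤ.+ d)) ℤ.≟ (f ℤ.* (a ℤ.+ c))
... | yes _ = norm (c ℤ.- a , d ℤ.- b)
... | no _  = (a ℤ.+ c , b ℤ.+ d)

State : Set
State = Fin 3 → Label × ℕ

lab : State → Fin 3 → Label
lab s i = proj₁ (s i)

num : State → Fin 3 → ℕ
num s i = proj₂ (s i)

others : Fin 3 → Fin 3 × Fin 3
others zero = (suc zero , suc (suc zero))
others (suc zero) = (zero , suc (suc zero))
others (suc (suc zero)) = (zero , suc zero)

set : State → Fin 3 → Label × ℕ → State
set s zero v zero = v
set s (suc zero) v (suc zero) = v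
set s (suc (suc zero)) v (suc (suc zero)) = v
set s i v j = s j

-- Mutation at position i: label updated by newLabel, number z replaced by
-- z' = (x²+xy+y²)/z (stated exactly: z * z' = x²+xy+y²).
data Mut (i : Fin 3) (s : State) : State → Set where
  mut : (z' : ℕ) →
        num s i ℕ.* z' ≡
          num s (proj₁ (others i)) ℕ.* num s (proj₁ (others i))
          ℕ.+ num s (proj₁ (others i)) ℕ.* num s (proj₂ (others i))
          ℕ.+ num s (proj₂ (others i)) ℕ.* num s (proj₂ (others i)) →
        Mut i s (set s i (newLabel (lab s (proj₁ (others i))) (lab s (proj₂ (others i))) (lab s i) , z'))

s₀ : State
s₀ zero = ((+ 0 , + 1) , 1)
s₀ (suc zero) = ((+ 1 , + 0) , 1)
s₀ (suc (suc zero)) = ((-[1+ 0 ] , + 1) , 1)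

-- Reach s j : s is obtained by a mutation sequence starting with position -1/1
-- (index 2), then position 1/0 (index 1), never mutating the same position
-- twice in a row; j is the last mutated position.
data Reach : State → Fin 3 → Set where
  start : ∀ {s₁ s₂} → Mut (suc (suc zero)) s₀ s₁ → Mut (suc zero) s₁ s₂ → Reach s₂ (suc zero)
  step  : ∀ {s s' j} (i : Fin 3) → i ≢ j → Reach s j → Mut i s s' → Reach s' i

Occurs : ℕ → ℕ → ℕ → Set
Occurs p q m = ∃[ s ] ∃[ j ] ∃[ i ] (Reach s j × (lab s i ≈L (+ p , + q)) × num s i ≡ m)

-- m / n as a rational (n = 0 never arises for Markov numbers; sent to 0).
ratio : ℕ → ℕ → ℚ
ratio m zero = 0ℚ
ratio m (suc n) = (+ m) ℚ./ suc n

-- Comparison of a rational x with L = (17 + √285)/2, the larger root of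
-- t² - 17 t + 1.  x < L  iff  2x - 17 < 0  or  (2x - 17)² < 285.
twoXm17 : ℚ → ℚ
twoXm17 x = (ℚ.1ℚ ℚ.+ ℚ.1ℚ) ℚ.* x ℚ.- ((+ 17) ℚ./ 1)

BelowL : ℚ → Set
BelowL x = (twoXm17 x ℚ.< 0ℚ) ⊎ (twoXm17 x ℚ.* twoXm17 x ℚ.< (+ 285) ℚ./ 1)

AboveL : ℚ → Set
AboveL x = (0ℚ ℚ.< twoXm17 x) × ((+ 285) ℚ./ 1 ℚ.< twoXm17 x ℚ.* twoXm17 x)

CloseToL : ℚ → ℚ → Set
CloseToL r ε = BelowL (r ℚ.- ε) × AboveL (r ℚ.+ ε)

{-# OPTIONS --safe #-}
module Submission where

-- Along every mutation sequence the labels stay fractions x/y of naturals; the last mutated label is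
-- the mediant of the other two, and these are Farey neighbours (|xv − yu| = 1). So every mutation takes
-- the mediant branch of newLabel, and a label p/(1 + p) is only ever created by mutating 1/0 or
-- (p − 2)/(p − 1) against 1/1 and (p − 1)/p, which by induction gives it the number m (1 + p). The triples
-- (m (q − 1), m q, 3) solve a Markov-type equation, which for A = m q and B = m (q − 1) reads
-- (2A − 17B)² + 4(3A + 3B + 9) = 285 B². Hence 0 < 285 − (2A/B − 17)² ≤ 270/B, while B is unbounded.

open import Defs

module Sequence where

  open import Data.Nat
  open import Data.Nat.Properties
  open import Data.Nat.Solver using (module +-*-Solver)
  open import Data.Product using (_×_; _,_)
  open import Relation.Binary.PropositionalEquality
  open +-*-Solver

  x²+xy+y² : ℕ → ℕ → ℕ
  x²+xy+y² x y = x * x + x * y + y * y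

  x²+xy+y²-sym : ∀ x y → x²+xy+y² x y ≡ x²+xy+y² y x
  x²+xy+y²-sym x y = solve 2 (λ x y → x :* x :+ x :* y :+ y :* y := y :* y :+ y :* x :+ x :* x) refl x y

  -- m (1 + p) is the number of p/(1 + p).
  m : ℕ → ℕ
  m 0 = 1
  m 1 = 1
  m (suc (suc n)) = 17 * m (suc n) ∸ m n ∸ 3

  recurrence-gap : ∀ x y z → z + y + 3 ≡ 17 * x → y + 3 ≤ x → x + 3 ≤ z
  recurrence-gap x y z eq y+3≤x with m≤n⇒∃[o]m+o≡n y+3≤x
  ... | t , refl = subst (y + 3 + t + 3 ≤_) (sym z≡) (m≤m+n _ _)
    where
    open ≡-Reasoning
    z≡ : z ≡ y + 3 + t + 3 + (15 * y + 42 + 16 * t)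
    z≡ = +-cancelʳ-≡ (y + 3) _ _ (begin
      z + (y + 3)       ≡⟨ sym (+-assoc z y 3) ⟩
      z + y + 3         ≡⟨ eq ⟩
      17 * (y + 3 + t)  ≡⟨ solve 2 (λ y t → con 17 :* (y :+ con 3 :+ t)
                             := y :+ con 3 :+ t :+ con 3 :+ (con 15 :* y :+ con 42 :+ con 16 :* t) :+ (y :+ con 3))
                             refl y t ⟩
      y + 3 + t + 3 + (15 * y + 42 + 16 * t) + (y + 3) ∎)

  mutual
    m-recurrence : ∀ n → m (2 + n) + m n + 3 ≡ 17 * m (1 + n)
    m-recurrence n = begin
      17 * m (1 + n) ∸ m n ∸ 3 + m n + 3   ≡⟨ +-assoc (17 * m (1 + n) ∸ m n ∸ 3) (m n) 3 ⟩
      17 * m (1 + n) ∸ m n ∸ 3 + (m n + 3) ≡⟨ cong (_+ (m n + 3)) (∸-+-assoc (17 * m (1 + n)) (m n) 3) ⟩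
      17 * m (1 + n) ∸ (m n + 3) + (m n + 3) ≡⟨ m∸n+n≡m (m[n]+3≤17*m[1+n] n) ⟩
      17 * m (1 + n) ∎
      where open ≡-Reasoning

    m[n]+3≤17*m[1+n] : ∀ n → m n + 3 ≤ 17 * m (1 + n)
    m[n]+3≤17*m[1+n] zero = s≤s (s≤s (s≤s (s≤s z≤n)))
    m[n]+3≤17*m[1+n] (suc n) = ≤-trans (m[1+n]+3≤m[2+n] n) (m≤n*m (m (2 + n)) 17)

    m[1+n]+3≤m[2+n] : ∀ n → m (1 + n) + 3 ≤ m (2 + n)
    m[1+n]+3≤m[2+n] zero = s≤s (s≤s (s≤s (s≤s z≤n)))
    m[1+n]+3≤m[2+n] (suc n) = recurrence-gap (m (2 + n)) (m (1 + n)) (m (3 + n)) (m-recurrence (suc n)) (m[1+n]+3≤m[2+n] n)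

  m-positive : ∀ n → 1 ≤ m n
  m-positive 0 = s≤s z≤n
  m-positive 1 = s≤s z≤n
  m-positive (suc (suc n)) = ≤-trans (m-positive (suc n)) (≤-trans (m≤m+n _ 3) (m[1+n]+3≤m[2+n] n))

  n≤m[n] : ∀ n → n ≤ m n
  n≤m[n] 0 = z≤n
  n≤m[n] 1 = s≤s z≤n
  n≤m[n] (suc (suc n)) = ≤-trans (s≤s (n≤m[n] (suc n))) (≤-trans (m<m+n (m (1 + n)) (s≤s z≤n)) (m[1+n]+3≤m[2+n] n))

  -- (m n, m (1 + n), 3) solves x² + y² + z² + xy + yz + zx = 6xyz; m's recurrence is Vieta's formula for it.
  mutual
    m-markov : ∀ n → m (1 + n) * m (1 + n) + m n * m n + 3 * m (1 + n) + 3 * m n + 9 ≡ 17 * m (1 + n) * m n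
    m-markov zero = refl
    m-markov (suc n) = begin
      z * z + y * y + 3 * z + 3 * y + 9 ≡⟨ solve 2 (λ z y → z :* z :+ y :* y :+ con 3 :* z :+ con 3 :* y :+ con 9
                                              := z :* z :+ con 3 :* z :+ (y :* y :+ y :* con 3 :+ con 3 :* con 3)) refl z y ⟩
      z * z + 3 * z + (y * y + y * 3 + 3 * 3) ≡⟨ cong (z * z + 3 * z +_) (sym (m-exchange n)) ⟩
      z * z + 3 * z + x * z                  ≡⟨ solve 2 (λ z x → z :* z :+ con 3 :* z :+ x :* z := z :* (z :+ x :+ con 3)) refl z x ⟩
      z * (z + x + 3)                        ≡⟨ cong (z *_) (m-recurrence n) ⟩
      z * (17 * y)                           ≡⟨ solve 2 (λ z y → z :* (con 17 :* y) := con 17 :* z :* y) refl z y ⟩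
      17 * z * y                             ∎
      where
      open ≡-Reasoning
      x = m n
      y = m (1 + n)
      z = m (2 + n)

    m-exchange : ∀ n → m n * m (2 + n) ≡ x²+xy+y² (m (1 + n)) 3
    m-exchange n = +-cancelʳ-≡ (x * x + 3 * x) _ _ (begin
      x * z + (x * x + 3 * x)          ≡⟨ solve 2 (λ z x → x :* z :+ (x :* x :+ con 3 :* x) := x :* (z :+ x :+ con 3)) refl z x ⟩
      x * (z + x + 3)                  ≡⟨ cong (x *_) (m-recurrence n) ⟩
      x * (17 * y)                     ≡⟨ solve 2 (λ x y → x :* (con 17 :* y) := con 17 :* y :* x) refl x y ⟩
      17 * y * x                       ≡⟨ sym (m-markov n) ⟩
      y * y + x * x + 3 * y + 3 * x + 9 ≡⟨ solve 2 (λ y x → y :* y :+ x :* x :+ con 3 :* y :+ con 3 :* x :+ con 9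
                                            := y :* y :+ y :* con 3 :+ con 3 :* con 3 :+ (x :* x :+ con 3 :* x)) refl y x ⟩
      y * y + y * 3 + 3 * 3 + (x * x + 3 * x) ∎)
      where
      open ≡-Reasoning
      x = m n
      y = m (1 + n)
      z = m (2 + n)

  m-exchange-unique : ∀ n z → m n * z ≡ x²+xy+y² (m (1 + n)) 3 → z ≡ m (2 + n)
  m-exchange-unique n z e = *-cancelˡ-≡ z (m (2 + n)) (m n) {{>-nonZero (m-positive n)}} (trans e (sym (m-exchange n)))

  16*m[2+n]≤m[3+n] : ∀ n → 16 * m (2 + n) ≤ m (3 + n)
  16*m[2+n]≤m[3+n] n = +-cancelʳ-≤ (m (1 + n) + 3) (16 * m (2 + n)) (m (3 + n)) (begin
    16 * m (2 + n) + (m (1 + n) + 3) ≤⟨ +-monoʳ-≤ (16 * m (2 + n)) (m[1+n]+3≤m[2+n] n) ⟩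
    16 * m (2 + n) + m (2 + n)       ≡⟨ solve 1 (λ b → con 16 :* b :+ b := con 17 :* b) refl (m (2 + n)) ⟩
    17 * m (2 + n)                   ≡⟨ m-recurrence (1 + n) ⟨
    m (3 + n) + m (1 + n) + 3        ≡⟨ +-assoc (m (3 + n)) (m (1 + n)) 3 ⟩
    m (3 + n) + (m (1 + n) + 3)      ∎)
    where open ≤-Reasoning

  m[2+n]≤17*m[1+n] : ∀ n → m (2 + n) ≤ 17 * m (1 + n)
  m[2+n]≤17*m[1+n] n = ≤-trans (≤-trans (m≤m+n (m (2 + n)) (m n)) (m≤m+n _ 3)) (≤-reflexive (m-recurrence n))

  discriminant : ∀ A B W → A * A + B * B + 3 * A + 3 * B + 9 ≡ 17 * A * B → W + 17 * B ≡ 2 * A →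
                 W * W + 4 * (3 * A + 3 * B + 9) ≡ 285 * (B * B)
  discriminant A B W markov W+17B≡2A = +-cancelʳ-≡ (34 * W * B + 293 * (B * B)) _ _ (begin
    W * W + 4 * (3 * A + 3 * B + 9) + (34 * W * B + 293 * (B * B))
      ≡⟨ solve 3 (λ w b a → w :* w :+ con 4 :* (con 3 :* a :+ con 3 :* b :+ con 9) :+ (con 34 :* w :* b :+ con 293 :* (b :* b))
                      := (w :+ con 17 :* b) :* (w :+ con 17 :* b) :+ con 4 :* (b :* b) :+ con 4 :* (con 3 :* a :+ con 3 :* b :+ con 9)) refl W B A ⟩
    (W + 17 * B) * (W + 17 * B) + 4 * (B * B) + 4 * (3 * A + 3 * B + 9)
      ≡⟨ cong (λ t → t * t + 4 * (B * B) + 4 * (3 * A + 3 * B + 9)) W+17B≡2A ⟩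
    (2 * A) * (2 * A) + 4 * (B * B) + 4 * (3 * A + 3 * B + 9)
      ≡⟨ solve 2 (λ a b → (con 2 :* a) :* (con 2 :* a) :+ con 4 :* (b :* b) :+ con 4 :* (con 3 :* a :+ con 3 :* b :+ con 9)
                      := con 4 :* (a :* a :+ b :* b :+ con 3 :* a :+ con 3 :* b :+ con 9)) refl A B ⟩
    4 * (A * A + B * B + 3 * A + 3 * B + 9)
      ≡⟨ cong (4 *_) markov ⟩
    4 * (17 * A * B)
      ≡⟨ solve 2 (λ a b → con 4 :* (con 17 :* a :* b) := con 34 :* (con 2 :* a) :* b) refl A B ⟩
    34 * (2 * A) * B
      ≡⟨ cong (λ t → 34 * t * B) W+17B≡2A ⟨
    34 * (W + 17 * B) * B
      ≡⟨ solve 2 (λ w b → con 34 :* (w :+ con 17 :* b) :* b := con 285 :* (b :* b) :+ (con 34 :* w :* b :+ con 293 :* (b :* b))) refl W B ⟩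
    285 * (B * B) + (34 * W * B + 293 * (B * B)) ∎)
    where open ≡-Reasoning

  -- W stands for (2A/B − 17)·B.
  ApproximatesL : ℕ → ℕ → ℕ → Set
  ApproximatesL A B W = W + 17 * B ≡ 2 * A × 15 * B ≤ W × W * W < 285 * (B * B) × 285 * (B * B) ≤ W * W + 270 * B

  m-approximatesL : ∀ n → ApproximatesL (m (3 + n)) (m (2 + n)) (2 * m (3 + n) ∸ 17 * m (2 + n))
  m-approximatesL n = W+17B≡2A , 15B≤W ,
    ≤-trans (m<m+n (W * W) (*-monoʳ-< 4 0<K)) (≤-reflexive W²+4K≡285B²) ,
    ≤-trans (≤-reflexive (sym W²+4K≡285B²)) (+-monoʳ-≤ (W * W) 4K≤270B)
    where
    A = m (3 + n)
    B = m (2 + n)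
    W = 2 * A ∸ 17 * B
    K = 3 * A + 3 * B + 9
    32B≤2A : 2 * (16 * B) ≤ 2 * A
    32B≤2A = *-monoʳ-≤ 2 (16*m[2+n]≤m[3+n] n)
    32B≡2[16B] : 32 * B ≡ 2 * (16 * B)
    32B≡2[16B] = *-assoc 2 16 B
    W+17B≡2A : W + 17 * B ≡ 2 * A
    W+17B≡2A = m∸n+n≡m (≤-trans (*-monoˡ-≤ B (m≤m+n 17 15)) (≤-trans (≤-reflexive 32B≡2[16B]) 32B≤2A))
    15B≤W : 15 * B ≤ W
    15B≤W = +-cancelʳ-≤ (17 * B) (15 * B) W (begin
      15 * B + 17 * B ≡⟨ *-distribʳ-+ B 15 17 ⟨
      32 * B          ≡⟨ 32B≡2[16B] ⟩
      2 * (16 * B)    ≤⟨ 32B≤2A ⟩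
      2 * A           ≡⟨ W+17B≡2A ⟨
      W + 17 * B      ∎)
      where open ≤-Reasoning
    W²+4K≡285B² : W * W + 4 * K ≡ 285 * (B * B)
    W²+4K≡285B² = discriminant A B W (m-markov (2 + n)) W+17B≡2A
    0<K : 0 < K
    0<K = ≤-trans (s≤s z≤n) (m≤n+m 9 (3 * A + 3 * B))
    4K≤270B : 4 * K ≤ 270 * B
    4K≤270B = begin
      4 * (3 * A + 3 * B + 9)
        ≤⟨ *-monoʳ-≤ 4 (+-mono-≤ (+-monoˡ-≤ (3 * B) (*-monoʳ-≤ 3 (m[2+n]≤17*m[1+n] (1 + n))))
                                                                    (*-monoʳ-≤ 9 (m-positive (2 + n)))) ⟩
      4 * (3 * (17 * B) + 3 * B + 9 * B)
        ≡⟨ solve 1 (λ b → con 4 :* (con 3 :* (con 17 :* b) :+ con 3 :* b :+ con 9 :* b) := con 252 :* b) refl B ⟩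
      252 * B
        ≤⟨ *-monoˡ-≤ B (m≤m+n 252 18) ⟩
      270 * B
        ∎
      where open ≤-Reasoning

module FareyPairs where

  open import Data.Nat
  open import Data.Nat.Properties
  open import Data.Nat.Divisibility using (_∣_; ∣1⇒≡1; ∣m+n∣m⇒∣n; m∣m*n)
  open import Data.Nat.Solver using (module +-*-Solver)
  open import Data.Product using (_×_; _,_; ∃-syntax)
  open import Data.Sum using (_⊎_; inj₁; inj₂)
  open import Data.Empty using (⊥-elim)
  open import Relation.Nullary using (¬_; yes; no)
  open import Relation.Binary.PropositionalEquality
  open +-*-Solver

  Frac : Set
  Frac = ℕ × ℕ

  _⊕_ : Frac → Frac → Frac
  (x , y) ⊕ (u , v) = (x + u , y + v)

  ⊕-comm : ∀ a b → a ⊕ b ≡ b ⊕ a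
  ⊕-comm (x , y) (u , v) = cong₂ _,_ (+-comm x u) (+-comm y v)

  _≐_ : Frac → Frac → Set
  (x , y) ≐ (u , v) = x * v ≡ y * u

  Neighbours : Frac → Frac → Set
  Neighbours (x , y) (u , v) = x * v ≡ suc (y * u) ⊎ y * u ≡ suc (x * v)

  neighbours-sym : ∀ a b → Neighbours a b → Neighbours b a
  neighbours-sym (x , y) (u , v) (inj₁ e) = inj₂ (trans (*-comm v x) (trans e (cong suc (*-comm y u))))
  neighbours-sym (x , y) (u , v) (inj₂ e) = inj₁ (trans (*-comm u y) (trans e (cong suc (*-comm x v))))

  neighbours-⊕ˡ : ∀ a b → Neighbours a b → Neighbours (a ⊕ b) b
  neighbours-⊕ˡ (x , y) (u , v) (inj₁ e) = inj₁ (begin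
    (x + u) * v       ≡⟨ *-distribʳ-+ v x u ⟩
    x * v + u * v     ≡⟨ cong (_+ u * v) e ⟩
    suc (y * u + u * v) ≡⟨ cong suc (solve 3 (λ y u v → y :* u :+ u :* v := (y :+ v) :* u) refl y u v) ⟩
    suc ((y + v) * u) ∎)
    where open ≡-Reasoning
  neighbours-⊕ˡ (x , y) (u , v) (inj₂ e) = inj₂ (begin
    (y + v) * u       ≡⟨ *-distribʳ-+ u y v ⟩
    y * u + v * u     ≡⟨ cong (_+ v * u) e ⟩
    suc (x * v + v * u) ≡⟨ cong suc (solve 3 (λ x u v → x :* v :+ v :* u := (x :+ u) :* v) refl x u v) ⟩
    suc ((x + u) * v) ∎)
    where open ≡-Reasoning

  ¬neighbours-0/0 : ∀ a → ¬ Neighbours a (0 , 0)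
  ¬neighbours-0/0 (x , y) (inj₁ e) = 0≢1+n (trans (sym (*-zeroʳ x)) (trans e (cong suc (*-zeroʳ y))))
  ¬neighbours-0/0 (x , y) (inj₂ e) = 0≢1+n (trans (sym (*-zeroʳ y)) (trans e (cong suc (*-zeroʳ x))))

  ¬neighbours-x/0 : ∀ x u → ¬ Neighbours (x , 0) (u , 0)
  ¬neighbours-x/0 x u (inj₁ e) = 0≢1+n (trans (sym (*-zeroʳ x)) e)
  ¬neighbours-x/0 x u (inj₂ e) = 0≢1+n (trans e (cong suc (*-zeroʳ x)))

  neighbours-distinct : ∀ a b → Neighbours a b → ¬ a ≐ b
  neighbours-distinct (x , y) (u , v) (inj₁ e) xv≡yu = m≢1+m+n (y * u) (trans (sym xv≡yu) (trans e (cong suc (sym (+-identityʳ _)))))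
  neighbours-distinct (x , y) (u , v) (inj₂ e) xv≡yu = m≢1+m+n (x * v) (trans xv≡yu (trans e (cong suc (sym (+-identityʳ _)))))

  neighbours-≭-⊕⊕ : ∀ a b → Neighbours a b → ¬ a ≐ ((a ⊕ b) ⊕ b)
  neighbours-≭-⊕⊕ (x , y) (u , v) nb eq = neighbours-distinct (x , y) (u , v) nb
    (*-cancelˡ-≡ (x * v) (y * u) 2 (+-cancelˡ-≡ (x * y) _ _ (begin
      x * y + 2 * (x * v) ≡⟨ solve 4 (λ x y u v → x :* y :+ con 2 :* (x :* v) := x :* (y :+ v :+ v)) refl x y u v ⟩
      x * (y + v + v)     ≡⟨ eq ⟩
      y * (x + u + u)     ≡⟨ solve 4 (λ x y u v → y :* (x :+ u :+ u) := x :* y :+ con 2 :* (y :* u)) refl x y u v ⟩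
      x * y + 2 * (y * u) ∎)))
    where open ≡-Reasoning

  private
    product-expansion : ∀ y t u → (y + t) * suc (t + u) ≡ y * u + (y + y * t + t * suc (t + u))
    product-expansion = solve 3 (λ y t u → (y :+ t) :* (con 1 :+ (t :+ u)) := y :* u :+ (y :+ y :* t :+ t :* (con 1 :+ (t :+ u)))) refl

    parent-shape : ∀ y t u → Neighbours (y + t , y) (u , suc (t + u)) → y + t ≡ 1 × y ≡ 1 × suc (t + u) ≡ suc u
    parent-shape y t u (inj₂ e) = ⊥-elim (m≢1+m+n (y * u) (trans e (cong suc (product-expansion y t u))))
    parent-shape y t u (inj₁ e) with t | +-cancelˡ-≡ (y * u) _ 1 (trans (sym (product-expansion y t u)) (trans e (+-comm 1 (y * u))))
    ... | zero | rest≡1 with trans (solve 1 (λ y → y := y :+ y :* con 0 :+ con 0) refl y) rest≡1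
    ...   | refl = refl , refl , refl
    parent-shape y t u (inj₁ e) | suc t' | rest≡1 =
      ⊥-elim (<-irrefl refl (≤-trans (s≤s (s≤s z≤n)) (≤-trans (m≤n+m _ (y + y * suc t')) (≤-reflexive rest≡1))))

    left-parent : ∀ x y u v → Neighbours (x , y) (u , v) → y + v ≡ suc (x + u) → y ≤ x →
                  x ≡ 1 × y ≡ 1 × v ≡ suc u
    left-parent x y u v nb eq y≤x with m≤n⇒∃[o]m+o≡n y≤x
    ... | t , refl with +-cancelˡ-≡ y v (suc (t + u)) (trans eq (trans (cong suc (+-assoc y t u)) (sym (+-suc y (t + u)))))
    ...   | refl = parent-shape y t u nb

  parents-of-n/1+n : ∀ x y u v → Neighbours (x , y) (u , v) → y + v ≡ suc (x + u) →
                     (x ≡ 1 × y ≡ 1 × v ≡ suc u) ⊎ (u ≡ 1 × v ≡ 1 × y ≡ suc x)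
  parents-of-n/1+n x y u v nb eq with y ≤? x
  ... | yes y≤x = inj₁ (left-parent x y u v nb eq y≤x)
  ... | no y≰x = inj₂ (left-parent u v x y (neighbours-sym (x , y) (u , v) nb) eq′ v≤u)
    where
    eq′ : v + y ≡ suc (u + x)
    eq′ = trans (+-comm v y) (trans eq (cong suc (+-comm x u)))
    v≤u : v ≤ u
    v≤u = +-cancelˡ-≤ (suc x) v u (≤-trans (+-monoˡ-≤ v (≰⇒> y≰x)) (≤-reflexive eq))

  private
    ≡1+multiple⇒≡1 : ∀ t a b → t * a ≡ suc (t * b) → t ≡ 1
    ≡1+multiple⇒≡1 t a b e =
      ∣1⇒≡1 (∣m+n∣m⇒∣n (subst (t ∣_) (trans e (+-comm 1 (t * b))) (m∣m*n a)) (m∣m*n b))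

  scaled-neighbours : ∀ t x y b → Neighbours (t * x , t * y) b → t ≡ 1
  scaled-neighbours t x y (u , v) (inj₁ e) =
    ≡1+multiple⇒≡1 t (x * v) (y * u) (trans (sym (*-assoc t x v)) (trans e (cong suc (*-assoc t y u))))
  scaled-neighbours t x y (u , v) (inj₂ e) =
    ≡1+multiple⇒≡1 t (y * u) (x * v) (trans (sym (*-assoc t y u)) (trans e (cong suc (*-assoc t x v))))

  proportional-n/1+n : ∀ x y p → x * suc p ≡ y * p → ∃[ t ] (x ≡ t * p × y ≡ t * suc p)
  proportional-n/1+n x y p e with x ≤? y
  ... | no x≰y = ⊥-elim (<-irrefl refl (begin-strict
    y * p      ≤⟨ *-monoˡ-≤ p (<⇒≤ (≰⇒> x≰y)) ⟩
    x * p      <⟨ +-monoˡ-< (x * p) (≤-trans (s≤s z≤n) (≰⇒> x≰y)) ⟩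
    x + x * p  ≡⟨ sym (*-suc x p) ⟩
    x * suc p  ≡⟨ e ⟩
    y * p      ∎))
    where open ≤-Reasoning
  ... | yes x≤y with m≤n⇒∃[o]m+o≡n x≤y
  ...   | t , refl = t , x≡tp , trans (cong (_+ t) x≡tp) (trans (+-comm (t * p) t) (sym (*-suc t p)))
    where
    x≡tp : x ≡ t * p
    x≡tp = +-cancelˡ-≡ (x * p) x (t * p) (trans (+-comm (x * p) x) (trans (sym (*-suc x p)) (trans e (*-distribʳ-+ p x t))))

  neighbour-n/1+n : ∀ x y p b → Neighbours (x , y) b → x * suc p ≡ y * p → x ≡ p × y ≡ suc p
  neighbour-n/1+n x y p b nb e with proportional-n/1+n x y p e
  ... | t , refl , refl with scaled-neighbours t p (suc p) b nb
  ...   | refl = +-identityʳ p , cong suc (+-identityʳ p)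

module ThreePositions where

  open import Data.Nat using (ℕ)
  open import Data.Fin using (Fin; zero; suc; _≟_)
  open import Data.Vec.Functional using (updateAt)
  open import Data.Vec.Functional.Properties using (updateAt-updates; updateAt-minimal)
  open import Data.Product using (_×_; _,_; proj₁; proj₂; ∃-syntax; swap)
  open import Data.Sum using (_⊎_; inj₁; inj₂)
  open import Data.Empty using (⊥-elim)
  open import Function using (const)
  open import Relation.Nullary using (yes; no)
  open import Relation.Binary.PropositionalEquality

  _≋_ : {A : Set} → A × A → A × A → Set
  p ≋ q = p ≡ q ⊎ p ≡ swap q

  ≋-sym : {A : Set} {p q : A × A} → p ≋ q → q ≋ p
  ≋-sym (inj₁ e) = inj₁ (sym e)
  ≋-sym (inj₂ e) = inj₂ (cong swap (sym e))

  third-position : ∀ {i j} → i ≢ j → ∃[ k ] (others j ≋ (i , k) × others i ≋ (j , k))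
  third-position {zero}             {zero}             i≢j = ⊥-elim (i≢j refl)
  third-position {zero}             {suc zero}         _   = suc (suc zero) , inj₁ refl , inj₁ refl
  third-position {zero}             {suc (suc zero)}   _   = suc zero , inj₁ refl , inj₂ refl
  third-position {suc zero}         {zero}             _   = suc (suc zero) , inj₁ refl , inj₁ refl
  third-position {suc zero}         {suc zero}         i≢j = ⊥-elim (i≢j refl)
  third-position {suc zero}         {suc (suc zero)}   _   = zero , inj₂ refl , inj₂ refl
  third-position {suc (suc zero)}   {zero}             _   = suc zero , inj₂ refl , inj₁ refl
  third-position {suc (suc zero)}   {suc zero}         _   = zero , inj₂ refl , inj₂ refl
  third-position {suc (suc zero)}   {suc (suc zero)}   i≢j = ⊥-elim (i≢j refl)

  On : {A : Set} → (A → A → A → Set) → (Fin 3 → A) → Fin 3 → Fin 3 × Fin 3 → Set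
  On R T i (a , b) = R (T i) (T a) (T b)

  on-≋ : {A : Set} (R : A → A → A → Set) → (∀ a b c → R a b c → R a c b) →
         ∀ T i {p q} → p ≋ q → On R T i p → On R T i q
  on-≋ R R-sym T i (inj₁ refl) r = r
  on-≋ R R-sym T i (inj₂ refl) r = R-sym _ _ _ r

  set≗updateAt : ∀ s i v k → set s i v k ≡ updateAt s i (const v) k
  set≗updateAt s zero             v zero             = refl
  set≗updateAt s zero             v (suc k)          = refl
  set≗updateAt s (suc zero)       v zero             = refl
  set≗updateAt s (suc zero)       v (suc zero)       = refl
  set≗updateAt s (suc zero)       v (suc (suc k))    = refl
  set≗updateAt s (suc (suc zero)) v zero             = refl
  set≗updateAt s (suc (suc zero)) v (suc zero)       = refl
  set≗updateAt s (suc (suc zero)) v (suc (suc zero)) = refl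

  first-other-≢ : ∀ i → proj₁ (others i) ≢ i
  first-other-≢ zero ()
  first-other-≢ (suc zero) ()
  first-other-≢ (suc (suc zero)) ()

  second-other-≢ : ∀ i → proj₂ (others i) ≢ i
  second-other-≢ zero ()
  second-other-≢ (suc zero) ()
  second-other-≢ (suc (suc zero)) ()

  position-cases : ∀ j k → k ≡ j ⊎ k ≡ proj₁ (others j) ⊎ k ≡ proj₂ (others j)
  position-cases zero             zero             = inj₁ refl
  position-cases zero             (suc zero)       = inj₂ (inj₁ refl)
  position-cases zero             (suc (suc zero)) = inj₂ (inj₂ refl)
  position-cases (suc zero)       zero             = inj₂ (inj₁ refl)
  position-cases (suc zero)       (suc zero)       = inj₁ refl
  position-cases (suc zero)       (suc (suc zero)) = inj₂ (inj₂ refl)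
  position-cases (suc (suc zero)) zero             = inj₂ (inj₁ refl)
  position-cases (suc (suc zero)) (suc zero)       = inj₂ (inj₂ refl)
  position-cases (suc (suc zero)) (suc (suc zero)) = inj₁ refl

  updateAt-preserves : ∀ {A : Set} (P : A → Set) (T : Fin 3 → A) i e →
                       (∀ k → P (T k)) → P e → ∀ k → P (updateAt T i (const e) k)
  updateAt-preserves P T i e P-T P-e k with k ≟ i
  ... | yes refl = subst P (sym (updateAt-updates i T)) P-e
  ... | no k≢i   = subst P (sym (updateAt-minimal k i T k≢i)) (P-T k)

  set-represents : ∀ {A : Set} (f : A → Label × ℕ) s T i e → (∀ k → s k ≡ f (T k)) →
                   ∀ k → set s i (f e) k ≡ f (updateAt T i (const e) k)
  set-represents f s T i e s≗fT k with k ≟ i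
  ... | yes refl = trans (set≗updateAt s i (f e) i) (trans (updateAt-updates i s) (cong f (sym (updateAt-updates i T))))
  ... | no k≢i   = trans (set≗updateAt s i (f e) k) (trans (updateAt-minimal k i s k≢i)
                     (trans (s≗fT k) (cong f (sym (updateAt-minimal k i T k≢i)))))

module Mutations where

  open import Data.Nat
  open import Data.Nat.Properties
  open import Data.Integer as ℤ using (+_)
  import Data.Integer.Properties as ℤ
  open import Data.Product using (_×_; _,_; uncurry)
  open import Data.Sum using (inj₁; inj₂)
  open import Data.Empty using (⊥-elim)
  open import Relation.Nullary using (¬_; yes; no)
  open import Relation.Binary.PropositionalEquality
  open Sequence
  open FareyPairs

  Correct : Frac → ℕ → Set
  Correct (x , y) n = (x ≡ 1 → y ≡ 0 → n ≡ 1) × (x ≡ 1 → y ≡ 1 → n ≡ 3) × (y ≡ suc x → n ≡ m y)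

  private
    a+b+b≡1⇒b≡0 : ∀ a b → a + b + b ≡ 1 → b ≡ 0
    a+b+b≡1⇒b≡0 a zero    _ = refl
    a+b+b≡1⇒b≡0 a (suc b) e = ⊥-elim (m+1+n≢0 a (m+n≡0⇒m≡0 (a + suc b) (suc-injective (trans (sym (+-suc (a + suc b) b)) e))))

    a+1+b≡1⇒a≡0×b≡0 : ∀ a b → a + suc b ≡ 1 → a ≡ 0 × b ≡ 0
    a+1+b≡1⇒a≡0×b≡0 zero    zero    _ = refl , refl
    a+1+b≡1⇒a≡0×b≡0 zero    (suc b) ()
    a+1+b≡1⇒a≡0×b≡0 (suc a) b       e = ⊥-elim (m+1+n≢0 a (suc-injective e))

  correct-mutation : ∀ xi yi xk yk ni nj nk n' → Neighbours (xi , yi) (xk , yk) →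
                     Correct (xi , yi) ni → Correct (xi + xk , yi + yk) nj → Correct (xk , yk) nk →
                     ni * n' ≡ x²+xy+y² nj nk →
                     Correct (xi + xk + xk , yi + yk + yk) n'
  correct-mutation xi yi xk yk ni nj nk n' nb
                   (ni-1/0 , _ , ni-n/1+n) (_ , nj-1/1 , nj-n/1+n) (_ , nk-1/1 , nk-n/1+n) exchange =
    not-1/0 , not-1/1 , n/1+n
    where
    not-1/0 : xi + xk + xk ≡ 1 → yi + yk + yk ≡ 0 → n' ≡ 1
    not-1/0 _ y≡0 with m+n≡0⇒m≡0 yi (m+n≡0⇒m≡0 (yi + yk) y≡0) | m+n≡0⇒n≡0 (yi + yk) y≡0
    ... | refl | refl = ⊥-elim (¬neighbours-x/0 xi xk nb)
    not-1/1 : xi + xk + xk ≡ 1 → yi + yk + yk ≡ 1 → n' ≡ 3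
    not-1/1 x≡1 y≡1 with a+b+b≡1⇒b≡0 xi xk x≡1 | a+b+b≡1⇒b≡0 yi yk y≡1
    ... | refl | refl = ⊥-elim (¬neighbours-0/0 (xi , yi) nb)
    n/1+n : yi + yk + yk ≡ suc (xi + xk + xk) → n' ≡ m (yi + yk + yk)
    n/1+n e with parents-of-n/1+n (xi + xk) (yi + yk) xk yk (neighbours-⊕ˡ (xi , yi) (xk , yk) nb) e
    ... | inj₁ (xj≡1 , yj≡1 , refl) with a+1+b≡1⇒a≡0×b≡0 yi xk yj≡1
    ...   | refl , refl with trans (sym (+-identityʳ xi)) xj≡1
    ...     | refl = begin
      n'                          ≡⟨ sym (*-identityˡ n') ⟩
      1 * n'                      ≡⟨ cong (_* n') (sym (ni-1/0 refl refl)) ⟩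
      ni * n'                     ≡⟨ exchange ⟩
      x²+xy+y² nj nk              ≡⟨ cong₂ x²+xy+y² (nj-1/1 refl refl) (nk-n/1+n refl) ⟩
      13                          ∎
      where open ≡-Reasoning
    n/1+n e | inj₂ (refl , refl , yj≡1+xj) with +-cancelʳ-≡ 1 yi (suc xi) yj≡1+xj
    ...   | refl = begin
      n'          ≡⟨ m-exchange-unique (suc xi) n' (begin
        m (suc xi) * n'             ≡⟨ cong (_* n') (sym (ni-n/1+n refl)) ⟩
        ni * n'                     ≡⟨ exchange ⟩
        x²+xy+y² nj nk              ≡⟨ cong₂ x²+xy+y² (trans (nj-n/1+n refl) (cong (λ t → m (suc t)) (+-comm xi 1)))
                                                        (nk-1/1 refl refl) ⟩
        x²+xy+y² (m (2 + xi)) 3     ∎) ⟩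
      m (3 + xi)  ≡⟨ cong (λ t → m (suc t)) (sym (trans (+-assoc xi 1 1) (+-comm xi 2))) ⟩
      m (suc xi + 1 + 1) ∎
      where open ≡-Reasoning

  Entry : Set
  Entry = Frac × ℕ

  ⟪_⟫ : Frac → Label
  ⟪ x , y ⟫ = + x , + y

  ⟦_⟧ : Entry → Label × ℕ
  ⟦ a , n ⟧ = ⟪ a ⟫ , n

  newLabel-mediant : ∀ a b c → ¬ c ≐ (a ⊕ b) → newLabel ⟪ a ⟫ ⟪ b ⟫ ⟪ c ⟫ ≡ ⟪ a ⊕ b ⟫
  newLabel-mediant (x , y) (u , v) (e , f) c≭a⊕b with + e ℤ.* + (y + v) ℤ.≟ + f ℤ.* + (x + u)
  ... | yes eq = ⊥-elim (c≭a⊕b (ℤ.+-injective (trans (ℤ.pos-* e (y + v)) (trans eq (sym (ℤ.pos-* f (x + u)))))))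
  ... | no _ = refl

  Mediant : Entry → Entry → Entry → Set
  Mediant (b , _) (a , _) (c , _) = b ≡ a ⊕ c × Neighbours a c

  mediant-sym : ∀ b a c → Mediant b a c → Mediant b c a
  mediant-sym _ (a , _) (c , _) (refl , nb) = ⊕-comm a c , neighbours-sym a c nb

  MediantMutation : Entry → Entry → Entry → ℕ → Set
  MediantMutation (a , _) (b , _) (c , _) z = ¬ a ≐ (b ⊕ c) × Neighbours b c × Correct (b ⊕ c) z

  mediantMutation-sym : ∀ z a b c → MediantMutation a b c z → MediantMutation a c b z
  mediantMutation-sym z (a , _) (b , _) (c , _) (a≭b⊕c , nb , correct) =
    (λ a≐c⊕b → a≭b⊕c (subst (a ≐_) (⊕-comm c b) a≐c⊕b)) ,
    neighbours-sym b c nb ,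
    subst (λ f → Correct f z) (⊕-comm b c) correct

  Exchange : Entry → Entry → Entry → ℕ → Set
  Exchange (_ , x) (_ , y) (_ , w) z = x * z ≡ x²+xy+y² y w

  exchange-sym : ∀ z a b c → Exchange a b c z → Exchange a c b z
  exchange-sym z _ (_ , y) (_ , w) e = trans e (x²+xy+y²-sym y w)

  mediant-mutation : ∀ {a b c z} → Mediant b a c →
                     uncurry Correct a → uncurry Correct b → uncurry Correct c →
                     Exchange a b c z → MediantMutation a b c z
  mediant-mutation {(xi , yi) , ni} {_ , nj} {(xk , yk) , nk} {z} (refl , nb) ci cj ck exchange =
    neighbours-≭-⊕⊕ (xi , yi) (xk , yk) nb ,
    neighbours-⊕ˡ (xi , yi) (xk , yk) nb ,
    correct-mutation xi yi xk yk ni nj nk z nb ci cj ck exchange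

module ReachableStates where

  open import Data.Nat using (suc; _*_)
  open import Data.Nat.Properties using (*-identityˡ)
  open import Data.Integer using (+_)
  import Data.Integer.Properties as ℤ
  open import Data.Fin using (Fin; zero; suc)
  open import Data.Vec.Functional using (updateAt)
  open import Data.Vec.Functional.Properties using (updateAt-updates; updateAt-minimal)
  open import Data.Product using (_×_; _,_; proj₁; proj₂; ∃-syntax; uncurry)
  open import Data.Sum using (inj₁; inj₂)
  open import Function using (const)
  open import Relation.Binary.PropositionalEquality
  open Sequence
  open FareyPairs
  open ThreePositions
  open Mutations

  record Invariant (s : State) (j : Fin 3) : Set where
    field
      entry      : Fin 3 → Entry
      represents : ∀ k → s k ≡ ⟦ entry k ⟧
      correct    : ∀ k → uncurry Correct (entry k)
      mediant    : On Mediant entry j (others j)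

  invariant-step : ∀ {s s' i j} → i ≢ j → Invariant s j → Mut i s s' → Invariant s' i
  invariant-step {s} {i = i} {j} i≢j inv (mut z eq) with third-position i≢j
  ... | k , j-others , i-others = record
    { entry      = T′
    ; represents = subst (λ v → ∀ k → set s i (v , z) k ≡ ⟦ T′ k ⟧) (sym new-label) (set-represents ⟦_⟧ s T i new represents)
    ; correct    = updateAt-preserves (uncurry Correct) T i new correct (proj₂ (proj₂ outcome))
    ; mediant    = mediant′
    }
    where
    open Invariant inv renaming (entry to T)
    o₁ = proj₁ (others i)
    o₂ = proj₂ (others i)
    new : Entry
    new = proj₁ (T o₁) ⊕ proj₁ (T o₂) , z
    T′ = updateAt T i (const new)
    -- Reoriented through k, the invariant says T j = T i ⊕ T k; the mutation replaces T i by T j ⊕ T k.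
    exchange : On (λ a b c → Exchange a b c z) T i (others i)
    exchange = trans (cong (_* z) (sym (num≡ i))) (trans eq (cong₂ x²+xy+y² (num≡ o₁) (num≡ o₂)))
      where num≡ = λ k → cong proj₂ (represents k)
    outcome : On (λ a b c → MediantMutation a b c z) T i (others i)
    outcome = on-≋ (λ a b c → MediantMutation a b c z) (mediantMutation-sym z) T i (≋-sym i-others)
      (mediant-mutation (on-≋ Mediant mediant-sym T j j-others mediant) (correct i) (correct j) (correct k)
        (on-≋ (λ a b c → Exchange a b c z) (exchange-sym z) T i i-others exchange))
    new-label : newLabel (lab s o₁) (lab s o₂) (lab s i) ≡ ⟪ proj₁ new ⟫
    new-label = trans (cong₂ (λ p q → newLabel p q (lab s i)) (lab≡ o₁) (lab≡ o₂))
                  (trans (cong (newLabel _ _) (lab≡ i))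
                         (newLabel-mediant (proj₁ (T o₁)) (proj₁ (T o₂)) (proj₁ (T i)) (proj₁ outcome)))
      where lab≡ = λ k → cong proj₁ (represents k)
    mediant′ : On Mediant T′ i (others i)
    mediant′ rewrite updateAt-updates i {const new} T
                   | updateAt-minimal o₁ i {const new} T (first-other-≢ i)
                   | updateAt-minimal o₂ i {const new} T (second-other-≢ i) = refl , proj₁ (proj₂ outcome)

  invariant-start : ∀ {s₁ s₂} → Mut (suc (suc zero)) s₀ s₁ → Mut (suc zero) s₁ s₂ → Invariant s₂ (suc zero)
  invariant-start (mut z₁ e₁) (mut z₂ e₂) = record
    { entry      = T
    ; represents = λ { zero → refl ; (suc zero) → refl ; (suc (suc zero)) → refl }
    ; correct    = λ { zero             → (λ ()) , (λ ()) , (λ _ → refl)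
                     ; (suc zero)       → (λ _ ()) , (λ _ ()) , (λ _ → z₂≡13)
                     ; (suc (suc zero)) → (λ _ ()) , (λ _ _ → z₁≡3) , (λ ()) }
    ; mediant    = refl , inj₂ refl
    }
    where
    z₁≡3 : z₁ ≡ 3
    z₁≡3 = trans (sym (*-identityˡ z₁)) e₁
    z₂≡13 : z₂ ≡ 13
    z₂≡13 = trans (sym (*-identityˡ z₂)) (trans e₂ (cong (x²+xy+y² 1) z₁≡3))
    T : Fin 3 → Entry
    T zero             = (0 , 1) , 1
    T (suc zero)       = (1 , 2) , z₂
    T (suc (suc zero)) = (1 , 1) , z₁

  reach-invariant : ∀ {s j} → Reach s j → Invariant s j
  reach-invariant (start mutation₁ mutation₂) = invariant-start mutation₁ mutation₂
  reach-invariant (step i i≢j reach mutation) = invariant-step i≢j (reach-invariant reach) mutation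

  HasNeighbour : Entry → Set
  HasNeighbour (a , _) = ∃[ b ] Neighbours a b

  mediant-neighbours : ∀ b a c → Mediant b a c → HasNeighbour b × HasNeighbour a × HasNeighbour c
  mediant-neighbours _ (a , _) (c , _) (refl , nb) = (c , neighbours-⊕ˡ a c nb) , (c , nb) , (a , neighbours-sym a c nb)

  has-neighbour : ∀ {s j} (inv : Invariant s j) k → HasNeighbour (Invariant.entry inv k)
  has-neighbour {j = j} inv k with position-cases j k | around-j
    where
    open Invariant inv
    around-j = mediant-neighbours (entry j) (entry (proj₁ (others j))) (entry (proj₂ (others j))) mediant
  ... | inj₁ refl        | nb , _ , _ = nb
  ... | inj₂ (inj₁ refl) | _ , nb , _ = nb
  ... | inj₂ (inj₂ refl) | _ , _ , nb = nb

  ≈L-n/1+n : ∀ x y p → (+ x , + y) ≈L (+ p , + suc p) → x * suc p ≡ y * p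
  ≈L-n/1+n x y p e = ℤ.+-injective (trans (ℤ.pos-* x (suc p)) (trans e (sym (ℤ.pos-* y p))))

  occurs-n/1+n : ∀ p n → Occurs p (suc p) n → n ≡ m (suc p)
  occurs-n/1+n p n (s , j , k , reach , label≈ , num≡n) = begin
    n                ≡⟨ sym num≡n ⟩
    num s k          ≡⟨ cong proj₂ (represents k) ⟩
    proj₂ (entry k)  ≡⟨ proj₂ (proj₂ (correct k)) (trans y≡1+p (cong suc (sym x≡p))) ⟩
    m y              ≡⟨ cong m y≡1+p ⟩
    m (suc p)        ∎
    where
    open ≡-Reasoning
    inv = reach-invariant reach
    open Invariant inv
    x = proj₁ (proj₁ (entry k))
    y = proj₂ (proj₁ (entry k))
    cross : x * suc p ≡ y * p
    cross = ≈L-n/1+n x y p (subst (_≈L (+ p , + suc p)) (cong proj₁ (represents k)) label≈)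
    x≡p×y≡1+p : x ≡ p × y ≡ suc p
    x≡p×y≡1+p = neighbour-n/1+n x y p _ (proj₂ (has-neighbour inv k)) cross
    x≡p = proj₁ x≡p×y≡1+p
    y≡1+p = proj₂ x≡p×y≡1+p

module Asymptotics where

  open Sequence using (ApproximatesL)

  open import Data.Nat as ℕ using (ℕ; zero; suc)
  import Data.Nat.Properties as ℕP
  open import Data.Integer as ℤ using (+_; -[1+_])
  open import Data.Empty using (⊥-elim)
  open import Data.Rational as ℚ using (ℚ; 0ℚ; 1ℚ; _+_; _*_; _-_; _≤_; _<_)
  import Data.Rational.Properties as ℚP
  import Data.Rational.Unnormalised as ℚᵘ
  open ℚᵘ using (mkℚᵘ)
  import Data.Rational.Unnormalised.Properties as ℚᵘP
  import Data.Integer.Properties as ℤP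
  open import Data.Rational.Solver using (module +-*-Solver)
  open import Data.Product using (_,_)
  open import Data.Sum using (inj₁; inj₂)
  open import Relation.Nullary using (yes; no)
  open import Relation.Binary.PropositionalEquality
  open import Algebra.Bundles using (Ring)
  open import Algebra.Properties.Semiring.Mult (Ring.semiring ℚP.+-*-ring) as Mult using () renaming (_×_ to _×ℚ_)
  open +-*-Solver

  0<p*q : ∀ {p q} → 0ℚ < p → 0ℚ < q → 0ℚ < p * q
  0<p*q {p} {q} 0<p 0<q = ℚP.positive⁻¹ (p * q) {{ℚP.pos*pos⇒pos p {{ℚ.positive 0<p}} q {{ℚ.positive 0<q}}}}

  p<p+q : ∀ p {q} → 0ℚ < q → p < p + q
  p<p+q p {q} 0<q = subst (_< p + q) (ℚP.+-identityʳ p) (ℚP.+-monoʳ-< p 0<q)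

  p≤p+q : ∀ p {q} → 0ℚ ≤ q → p ≤ p + q
  p≤p+q p {q} 0≤q = subst (_≤ p + q) (ℚP.+-identityʳ p) (ℚP.+-monoʳ-≤ p 0≤q)

  ι : ℕ → ℚ
  ι n = n ×ℚ 1ℚ

  ι-+ : ∀ m n → ι (m ℕ.+ n) ≡ ι m + ι n
  ι-+ = Mult.×-homo-+ 1ℚ

  ι-* : ∀ m n → ι (m ℕ.* n) ≡ ι m * ι n
  ι-* = Mult.×1-homo-*

  0≤ι : ∀ n → 0ℚ ≤ ι n
  0≤ι zero    = ℚP.≤-refl
  0≤ι (suc n) = ℚP.≤-trans (0≤ι n) (subst (_≤ 1ℚ + ι n) (ℚP.+-identityˡ (ι n))
                                        (ℚP.+-monoˡ-≤ (ι n) (ℚP.nonNegative⁻¹ 1ℚ)))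

  ι-mono-≤ : ∀ {m n} → m ℕ.≤ n → ι m ≤ ι n
  ι-mono-≤ {m} m≤n with ℕP.m≤n⇒∃[o]m+o≡n m≤n
  ... | k , refl = subst (ι m ≤_) (sym (ι-+ m k)) (p≤p+q (ι m) (0≤ι k))

  ι-mono-< : ∀ {m n} → m ℕ.< n → ι m < ι n
  ι-mono-< {m} {suc n} (ℕ.s≤s m≤n) =
    ℚP.≤-<-trans (ι-mono-≤ m≤n) (subst (ι n <_) (ℚP.+-comm (ι n) 1ℚ) (p<p+q (ι n) (ℚP.positive⁻¹ 1ℚ)))

  toℚᵘ-ι : ∀ n → ℚ.toℚᵘ (ι n) ℚᵘ.≃ mkℚᵘ (+ n) 0
  toℚᵘ-ι zero    = ℚᵘ.*≡* refl
  toℚᵘ-ι (suc n) = ℚᵘP.≃-trans (ℚP.toℚᵘ-homo-+ 1ℚ (ι n)) (ℚᵘP.≃-trans (ℚᵘP.+-congʳ (ℚ.toℚᵘ 1ℚ) (toℚᵘ-ι n))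
                     (ℚᵘ.*≡* (cong (λ i → (+ 1 ℤ.+ i) ℤ.* + 1) (ℤP.*-identityʳ (+ n)))))

  /-*-ι : ∀ k d → ((+ k) ℚ./ suc d) * ι (suc d) ≡ ι k
  /-*-ι k d = ℚP.toℚᵘ-injective (ℚᵘP.≃-trans (ℚP.toℚᵘ-homo-* ((+ k) ℚ./ suc d) (ι (suc d)))
    (ℚᵘP.≃-trans (ℚᵘP.*-cong (ℚP.toℚᵘ-fromℚᵘ (mkℚᵘ (+ k) d)) (toℚᵘ-ι (suc d)))
    (ℚᵘP.≃-trans (ℚᵘ.*≡* (trans (ℤP.*-identityʳ _) (cong (λ n → + k ℤ.* + suc n) (sym (ℕP.*-identityʳ d)))))
    (ℚᵘP.≃-sym (toℚᵘ-ι k)))))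

  twoXm17[r+ε] : ∀ r ε → twoXm17 (r + ε) ≡ twoXm17 r + ι 2 * ε
  twoXm17[r+ε] r ε = solve 4 (λ r e t s → t :* (r :+ e) :+ (:- s) := t :* r :+ (:- s) :+ t :* e) refl r ε (ι 2) (ι 17)

  twoXm17[r-ε] : ∀ r ε → twoXm17 r ≡ twoXm17 (r - ε) + ι 2 * ε
  twoXm17[r-ε] r ε = solve 4 (λ r e t s → t :* r :+ (:- s) := t :* (r :+ (:- e)) :+ (:- s) :+ t :* e) refl r ε (ι 2) (ι 17)

  closeToL-criterion : ∀ r ε → 0ℚ < ε → 0ℚ < twoXm17 r →
                       twoXm17 r * twoXm17 r < ι 285 →
                       ι 285 ≤ twoXm17 r * twoXm17 r + ι 2 * ε * twoXm17 r →
                       CloseToL r ε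
  closeToL-criterion r ε 0<ε 0<w w²<285 285≤w²+2εw = below , above
    where
    w = twoXm17 r
    2ε = ι 2 * ε
    0<2ε : 0ℚ < 2ε
    0<2ε = 0<p*q (ℚP.positive⁻¹ (ι 2)) 0<ε
    below : BelowL (r - ε)
    below with twoXm17 (r - ε) ℚP.<? 0ℚ
    ... | yes u<0 = inj₁ u<0
    ... | no u≮0 = inj₂ (begin-strict
      u * u  ≤⟨ ℚP.*-monoˡ-≤-nonNeg u {{ℚ.nonNegative 0≤u}} u≤w ⟩
      u * w  ≤⟨ ℚP.*-monoʳ-≤-nonNeg w {{ℚ.nonNegative (ℚP.<⇒≤ 0<w)}} u≤w ⟩
      w * w  <⟨ w²<285 ⟩
      ι 285  ∎)
      where
      open ℚP.≤-Reasoning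
      u = twoXm17 (r - ε)
      0≤u : 0ℚ ≤ u
      0≤u = ℚP.≮⇒≥ u≮0
      u≤w : u ≤ w
      u≤w = subst (u ≤_) (sym (twoXm17[r-ε] r ε)) (p≤p+q u (ℚP.<⇒≤ 0<2ε))
    above : AboveL (r + ε)
    above = subst (0ℚ <_) (sym (twoXm17[r+ε] r ε)) (ℚP.<-trans 0<w (p<p+q w 0<2ε)) ,
            subst (ι 285 <_) (sym (cong (λ v → v * v) (twoXm17[r+ε] r ε))) (begin-strict
      ι 285                            ≤⟨ 285≤w²+2εw ⟩
      w * w + 2ε * w                   <⟨ p<p+q (w * w + 2ε * w) (0<p*q 0<2ε (ℚP.<-trans 0<w (p<p+q w 0<2ε))) ⟩
      w * w + 2ε * w + 2ε * (w + 2ε)   ≡⟨ solve 2 (λ w e → w :* w :+ e :* w :+ e :* (w :+ e) := (w :+ e) :* (w :+ e)) refl w 2ε ⟩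
      (w + 2ε) * (w + 2ε)              ∎)
      where open ℚP.≤-Reasoning

  closeToL-scaled : ∀ r ε β ω → 0ℚ < ε → 0ℚ < β → 0ℚ < ω → twoXm17 r * β ≡ ω →
                    ω * ω < ι 285 * (β * β) → ι 285 * (β * β) ≤ ω * ω + ι 2 * ε * ω * β →
                    CloseToL r ε
  closeToL-scaled r ε β ω 0<ε 0<β 0<ω wβ≡ω ω²<285β² 285β²≤ = closeToL-criterion r ε 0<ε
    (ℚP.*-cancelʳ-<-nonNeg β {{β≥0}} (subst₂ _<_ (sym (ℚP.*-zeroˡ β)) (sym wβ≡ω) 0<ω))
    (ℚP.*-cancelʳ-<-nonNeg (β * β) {{β²≥0}} (subst (_< ι 285 * (β * β)) (sym w²β²≡ω²) ω²<285β²))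
    (ℚP.*-cancelʳ-≤-pos (β * β) {{ℚ.positive (0<p*q 0<β 0<β)}}
      (subst (ι 285 * (β * β) ≤_) (sym [w²+2εw]β²≡ω²+2εωβ) 285β²≤))
    where
    w = twoXm17 r
    β≥0 = ℚ.nonNegative (ℚP.<⇒≤ 0<β)
    β²≥0 = ℚ.nonNegative (ℚP.<⇒≤ (0<p*q 0<β 0<β))
    w²β²≡ω² : w * w * (β * β) ≡ ω * ω
    w²β²≡ω² = trans (solve 2 (λ w b → w :* w :* (b :* b) := (w :* b) :* (w :* b)) refl w β) (cong (λ t → t * t) wβ≡ω)
    [w²+2εw]β²≡ω²+2εωβ : (w * w + ι 2 * ε * w) * (β * β) ≡ ω * ω + ι 2 * ε * ω * β
    [w²+2εw]β²≡ω²+2εωβ = trans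
      (solve 4 (λ w b t e → (w :* w :+ t :* e :* w) :* (b :* b) := (w :* b) :* (w :* b) :+ t :* e :* (w :* b) :* b) refl w β (ι 2) ε)
      (cong (λ t → t * t + ι 2 * ε * t * β) wβ≡ω)

  approximatesL⇒closeToL : ∀ A B W ε → 0ℚ < ε → 1 ℕ.≤ B → ApproximatesL A B W → ι 9 ≤ ε * ι B → CloseToL (ratio A B) ε
  approximatesL⇒closeToL A B@(suc b) W ε 0<ε (ℕ.s≤s ℕ.z≤n) (W+17B≡2A , 15B≤W , W²<285B² , 285B²≤W²+270B) 9≤εβ =
    closeToL-scaled r ε β ω 0<ε
      (ι-mono-< {0} {B} (ℕ.s≤s ℕ.z≤n)) (ι-mono-< {0} {W} (ℕP.≤-trans (ℕ.s≤s ℕ.z≤n) 15B≤W)) wβ≡ω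
      (subst₂ _<_ (ι-* W W) ι[285B²] (ι-mono-< W²<285B²))
      (begin
        ι 285 * (β * β)            ≡⟨ ι[285B²] ⟨
        ι (285 ℕ.* (B ℕ.* B))      ≤⟨ ι-mono-≤ 285B²≤W²+270B ⟩
        ι (W ℕ.* W ℕ.+ 270 ℕ.* B)  ≡⟨ trans (ι-+ (W ℕ.* W) (270 ℕ.* B)) (cong₂ _+_ (ι-* W W) (ι-* 270 B)) ⟩
        ω * ω + ι 270 * β          ≤⟨ ℚP.+-monoʳ-≤ (ω * ω) 270β≤2εωβ ⟩
        ω * ω + ι 2 * ε * ω * β    ∎)
    where
    open ℚP.≤-Reasoning
    r = ratio A B
    β = ι B
    ω = ι W
    ι[285B²] : ι (285 ℕ.* (B ℕ.* B)) ≡ ι 285 * (β * β)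
    ι[285B²] = trans (ι-* 285 (B ℕ.* B)) (cong (ι 285 *_) (ι-* B B))
    wβ≡ω : twoXm17 r * β ≡ ω
    wβ≡ω = begin-equality
      twoXm17 r * β
        ≡⟨ solve 4 (λ r b t s → (t :* r :+ (:- s)) :* b := t :* (r :* b) :+ (:- (s :* b))) refl r β (ι 2) (ι 17) ⟩
      ι 2 * (r * β) - ι 17 * β              ≡⟨ cong (λ t → ι 2 * t - ι 17 * β) (/-*-ι A b) ⟩
      ι 2 * ι A - ι 17 * β                  ≡⟨ cong₂ _-_ (ι-* 2 A) (ι-* 17 B) ⟨
      ι (2 ℕ.* A) - ι (17 ℕ.* B)            ≡⟨ cong (λ n → ι n - ι (17 ℕ.* B)) W+17B≡2A ⟨
      ι (W ℕ.+ 17 ℕ.* B) - ι (17 ℕ.* B)     ≡⟨ cong (_- ι (17 ℕ.* B)) (ι-+ W (17 ℕ.* B)) ⟩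
      ι W + ι (17 ℕ.* B) - ι (17 ℕ.* B)     ≡⟨ solve 2 (λ w x → w :+ x :+ (:- x) := w) refl (ι W) (ι (17 ℕ.* B)) ⟩
      ω                                     ∎
    270β≤2εωβ : ι 270 * β ≤ ι 2 * ε * ω * β
    270β≤2εωβ = begin
      ι 270 * β                    ≡⟨ solve 4 (λ b t n f → t :* n :* f :* b := t :* n :* (f :* b)) refl β (ι 2) (ι 9) (ι 15) ⟩
      ι 2 * ι 9 * (ι 15 * β)       ≤⟨ ℚP.*-monoʳ-≤-nonNeg (ι 15 * β) {{15β≥0}}
                                        (ℚP.*-monoˡ-≤-nonNeg (ι 2) {{ℚ.nonNegative (0≤ι 2)}} 9≤εβ) ⟩
      ι 2 * (ε * β) * (ι 15 * β)   ≤⟨ ℚP.*-monoˡ-≤-nonNeg (ι 2 * (ε * β)) {{2εβ≥0}}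
                                        (subst (_≤ ω) (ι-* 15 B) (ι-mono-≤ 15B≤W)) ⟩
      ι 2 * (ε * β) * ω            ≡⟨ solve 4 (λ t e w b → t :* (e :* b) :* w := t :* e :* w :* b) refl (ι 2) ε ω β ⟩
      ι 2 * ε * ω * β              ∎
      where
      15β≥0 = ℚ.nonNegative (subst (0ℚ ≤_) (ι-* 15 B) (0≤ι (15 ℕ.* B)))
      2εβ≥0 = ℚP.nonNeg*nonNeg⇒nonNeg (ι 2) {{ℚ.nonNegative (0≤ι 2)}}
                                       (ε * β) {{ℚ.nonNegative (ℚP.≤-trans (0≤ι 9) 9≤εβ)}}

  9≤ε*ι : ∀ ε → 0ℚ < ε → ∀ B → 9 ℕ.* ℚ.↧ₙ ε ℕ.≤ B → ι 9 ≤ ε * ι B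
  9≤ε*ι ε@(ℚ.mkℚ (+ zero) _ _) 0<ε = ⊥-elim (ℚP.<-irrefl refl (ℚP.<-≤-trans 0<ε (ℚP.nonPositive⁻¹ ε)))
  9≤ε*ι ε@(ℚ.mkℚ -[1+ _ ] _ _) 0<ε = ⊥-elim (ℚP.<-irrefl refl (ℚP.<-trans 0<ε (ℚP.negative⁻¹ ε)))
  9≤ε*ι ε@(ℚ.mkℚ (+ suc k) d _) 0<ε B 9[1+d]≤B = begin
    ι 9                      ≤⟨ ι-mono-≤ (ℕP.m≤m*n 9 (suc k)) ⟩
    ι (9 ℕ.* suc k)          ≡⟨ ι-* 9 (suc k) ⟩
    ι 9 * ι (suc k)          ≡⟨ cong (ι 9 *_) (trans (cong (_* ι (suc d)) (sym (ℚP.↥p/↧p≡p ε))) (/-*-ι (suc k) d)) ⟨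
    ι 9 * (ε * ι (suc d))    ≡⟨ solve 3 (λ n e d → n :* (e :* d) := e :* (n :* d)) refl (ι 9) ε (ι (suc d)) ⟩
    ε * (ι 9 * ι (suc d))    ≡⟨ cong (ε *_) (ι-* 9 (suc d)) ⟨
    ε * ι (9 ℕ.* suc d)      ≤⟨ ℚP.*-monoˡ-≤-nonNeg ε {{ℚ.nonNegative (ℚP.<⇒≤ 0<ε)}} (ι-mono-≤ 9[1+d]≤B) ⟩
    ε * ι B                  ∎
    where open ℚP.≤-Reasoning

open import Data.Nat using (ℕ; _≤_; _∸_; _*_; _+_; suc; s≤s; z≤n)
open import Data.Nat.Properties using (≤-trans)
open import Data.Rational as ℚ using (ℚ; 0ℚ; _<_)
open import Data.Product using (∃-syntax; _,_)
open import Relation.Binary.PropositionalEquality using (subst₂; sym)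
open Sequence using (m; m-positive; n≤m[n]; m-approximatesL)
open ReachableStates using (occurs-n/1+n)
open Asymptotics using (approximatesL⇒closeToL; 9≤ε*ι)

proposition4p11 : (ε : ℚ) → 0ℚ < ε → ∃[ N ] ((q : ℕ) → N ≤ q → 3 ≤ q →
                    (m₁ m₂ : ℕ) → Occurs (q ∸ 1) q m₁ → Occurs (q ∸ 2) (q ∸ 1) m₂ →
                    CloseToL (ratio m₁ m₂) ε)
proposition4p11 ε 0<ε = suc (9 * ℚ.↧ₙ ε) , λ where
  .(3 + r) (s≤s 9d≤2+r) (s≤s (s≤s (s≤s {n = r} z≤n))) m₁ m₂ occurs₁ occurs₂ →
    subst₂ (λ a b → CloseToL (ratio a b) ε) (sym (occurs-n/1+n (2 + r) m₁ occurs₁)) (sym (occurs-n/1+n (1 + r) m₂ occurs₂))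
      (approximatesL⇒closeToL (m (3 + r)) (m (2 + r)) _ ε 0<ε (m-positive (2 + r)) (m-approximatesL r)
        (9≤ε*ι ε 0<ε (m (2 + r)) (≤-trans 9d≤2+r (n≤m[n] (2 + r)))))
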